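{- Let $n \ge 2$ be an integer and $G$ a graph. If $G \times K_n$ is well-covered, then for every vertex $x\in V(G)$ with $\deg(x) \ge n$, the graph $G - N[x]$ has at least one isolated vertex.
   Context: Graphs are finite and simple. The direct product $G\times H$ has vertex set $V(G)\times V(H)$, with $(g_1,h_1)(g_2,h_2)$ an edge iff $g_1g_2\in E(G)$ and $h_1h_2\in E(H)$. $K_n$ is the complete graph on $n$ vertices. A graph is well-covered if all of its maximal independent sets have the same cardinality. $N[x]$ is the closed neighborhood of $x$. -}

module Defs where

open import Data.Nat using (ℕ)
import Data.Nat
open import Data.Empty using (⊥-elim)
open import Data.Bool using (Bool; true; false; _∧_; not)
open import Data.Bool.Properties using (∧-comm)
open import Data.Fin using (Fin; _≟_; quotient; remainder)
open import Data.Fin.Subset using (Subset; _∈_; _∉_; _⊆_; ⁅_⁆; _∪_; ∣_∣)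
open import Data.Vec using (tabulate)
open import Data.Product using (_×_; Σ-syntax)
open import Relation.Nullary using (Dec; yes; no; ¬_)
open import Relation.Nullary.Decidable using (⌊_⌋)
open import Relation.Binary.PropositionalEquality using (_≡_; refl; sym; cong₂)

record Graph (v : ℕ) : Set where
  field
    adj    : Fin v → Fin v → Bool
    adj-sym    : ∀ x y → adj x y ≡ adj y x
    adj-irrefl : ∀ x → adj x x ≡ false
open Graph public

private
  ≟-sym : ∀ {n} (x y : Fin n) → ⌊ x ≟ y ⌋ ≡ ⌊ y ≟ x ⌋
  ≟-sym x y with x ≟ y | y ≟ x
  ... | yes _ | yes _ = refl
  ... | no _  | no _  = refl
  ... | yes p | no q  = ⊥-elim (q (sym p))
  ... | no p  | yes q = ⊥-elim (p (sym q))

  ≟-refl : ∀ {n} (x : Fin n) → ⌊ x ≟ x ⌋ ≡ true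
  ≟-refl x with x ≟ x
  ... | yes _ = refl
  ... | no q  = ⊥-elim (q refl)

K : (n : ℕ) → Graph n
K n = record
  { adj    = λ x y → not ⌊ x ≟ y ⌋
  ; adj-sym    = λ x y → cong₂ (λ a _ → not a) (≟-sym x y) (refl {x = x})
  ; adj-irrefl = λ x → cong₂ (λ a _ → not a) (≟-refl x) (refl {x = x})
  }

-- Its vertex set Fin (m * n)
-- is identified with Fin m × Fin n via the stdlib bijection remQuot/combine
-- (quotient gives the G-coordinate, remainder the H-coordinate).
_×ᴳ_ : ∀ {m n} → Graph m → Graph n → Graph (m Data.Nat.* n)
_×ᴳ_ {m} {n} G H = record
  { adj    = λ k l → adj G (quotient n k) (quotient n l) ∧ adj H (remainder {m} n k) (remainder {m} n l)
  ; adj-sym    = λ k l → cong₂ _∧_ (Graph.adj-sym G (quotient n k) (quotient n l))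
                                 (Graph.adj-sym H (remainder {m} n k) (remainder {m} n l))
  ; adj-irrefl = λ k → ∧-false (Graph.adj-irrefl G (quotient n k))
  }
  where
  ∧-false : ∀ {a b} → a ≡ false → (a ∧ b) ≡ false
  ∧-false refl = refl

Independent : ∀ {v} → Graph v → Subset v → Set
Independent G S = ∀ x y → x ∈ S → y ∈ S → adj G x y ≡ false

MaximalIndependent : ∀ {v} → Graph v → Subset v → Set
MaximalIndependent G S =
  Independent G S × (∀ T → Independent G T → S ⊆ T → T ⊆ S)

WellCovered : ∀ {v} → Graph v → Set
WellCovered G = ∀ S T → MaximalIndependent G S → MaximalIndependent G T → ∣ S ∣ ≡ ∣ T ∣

N : ∀ {v} → Graph v → Fin v → Subset v
N G x = tabulate (adj G x)

N[_,_] : ∀ {v} → Graph v → Fin v → Subset v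
N[ G , x ] = ⁅ x ⁆ ∪ N G x

deg : ∀ {v} → Graph v → Fin v → ℕ
deg G x = ∣ N G x ∣

IsolatedInMinus : ∀ {v} → Graph v → Subset v → Fin v → Set
IsolatedInMinus G W y = y ∉ W × (∀ z → z ∉ W → adj G y z ≡ false)

HasIsolatedVertexMinus : ∀ {v} → Graph v → Subset v → Set
HasIsolatedVertexMinus G W = Σ[ y ∈ Fin _ ] IsolatedInMinus G W y

-- If G − N[x] had no isolated vertex then, as x has a neighbour, G would have none
-- either, and the layer V(G) × {0} would be a maximal independent set of G × Kₙ of
-- size |V(G)|. So is T = ({x} × V(Kₙ)) ∪ ((V(G) ∖ N[x]) × {0}): a vertex (a , i) with
-- a ∈ N(x) is adjacent to (x , j) for any j ≠ i, which exists as n ≥ 2, and one with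
-- a ∉ N[x], i ≠ 0 is adjacent to (b , 0) for a neighbour b ∉ N[x] of a. But
-- |T| = n + |V(G)| − 1 − deg x, so well-coveredness forces deg x = n − 1.
module Submission where

open import Defs
open import Data.Nat using (ℕ; zero; suc; _+_; _*_; _≤_; _<_; s≤s; z≤n)
open import Data.Nat.Properties
  using (+-0-commutativeMonoid; +-assoc; +-comm; *-identityʳ; +-cancelʳ-≡; suc-injective; <⇒≢; ≤-trans)
open import Algebra.Properties.CommutativeMonoid.Sum +-0-commutativeMonoid
  using (sum; sum-syntax; sum-cong-≗; ∑-distrib-+; sum-remove)
open import Data.Bool using (Bool; true; false; _∧_; if_then_else_)
open import Data.Bool.Properties using (∧-zeroʳ; ¬-not)
import Data.Bool.Properties as Bool
open import Data.Fin using (Fin; zero; suc; _≟_; _↑ˡ_; _↑ʳ_; combine; quotient; remainder; punchIn)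
open import Data.Fin.Properties using (remQuot-combine; punchInᵢ≢i; any?; all?; ¬∀⟶∃¬)
open import Data.Fin.Subset using (Subset; inside; outside; _∈_; _∉_; _⊆_; ⁅_⁆; _∪_; ∣_∣; ⊤; ⊥; Nonempty)
open import Data.Fin.Subset.Properties
  using (_∈?_; nonempty?; Empty-unique; ∣⊥∣≡0; ∣⊤∣≡n; ∣⁅x⁆∣≡1; ∪-identityˡ;
         x∈⁅x⁆; x∈⁅y⁆⇒x≡y; x∉⁅y⁆⇒x≢y; x∈p∪q⁺; x∈p∪q⁻; ∈⊤; ∉⊥)
open import Data.Vec using (tabulate; lookup; _∷_; []; here; there)
open import Data.Vec.Properties using (lookup∘tabulate; tabulate∘lookup; tabulate-cong; []=⇒lookup; lookup⇒[]=)
open import Data.Product using (Σ-syntax; _×_; _,_)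
open import Data.Sum using (_⊎_; inj₁; inj₂)
open import Function using (_∘_)
open import Relation.Nullary using (Dec; does; yes; no; ¬?; contradiction; _×-dec_; _→-dec_)
open import Relation.Binary.PropositionalEquality
  using (_≡_; _≢_; refl; sym; trans; cong; cong₂; subst; module ≡-Reasoning)

𝟙 : ∀ {p} {P : Set p} → Dec P → ℕ
𝟙 P? = if does P? then 1 else 0

∑-const : ∀ k c → ∑[ i < k ] c ≡ k * c
∑-const zero    c = refl
∑-const (suc k) c = cong (c +_) (∑-const k c)

∑-except : ∀ {k} c (f : Fin k → ℕ) x → (∀ a → a ≢ x → f a ≡ c) →
           ∑[ a < k ] f a + c ≡ f x + k * c
∑-except {suc k} c f x f≡c = begin
  sum f + c                             ≡⟨ cong (_+ c) (sum-remove {i = x} f) ⟩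
  f x + ∑[ j < k ] f (punchIn x j) + c  ≡⟨ cong (λ s → f x + s + c) (sum-cong-≗ (λ j → f≡c _ (punchInᵢ≢i x j))) ⟩
  f x + ∑[ j < k ] c + c                ≡⟨ cong (λ s → f x + s + c) (∑-const k c) ⟩
  f x + k * c + c                       ≡⟨ +-assoc (f x) (k * c) c ⟩
  f x + (k * c + c)                     ≡⟨ cong (f x +_) (+-comm (k * c) c) ⟩
  f x + suc k * c                       ∎
  where open ≡-Reasoning

∣p∣≡∑𝟙 : ∀ {k} (p : Subset k) → ∣ p ∣ ≡ ∑[ i < k ] 𝟙 (i ∈? p)
∣p∣≡∑𝟙 []            = refl
∣p∣≡∑𝟙 (inside  ∷ p) = cong suc (∣p∣≡∑𝟙 p)
∣p∣≡∑𝟙 (outside ∷ p) = ∣p∣≡∑𝟙 p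

∣⁅i⁆∪p∣ : ∀ {k} {i : Fin k} {p : Subset k} → i ∉ p → ∣ ⁅ i ⁆ ∪ p ∣ ≡ suc ∣ p ∣
∣⁅i⁆∪p∣ {i = zero}  {outside ∷ p} _   = cong (suc ∘ ∣_∣) (∪-identityˡ p)
∣⁅i⁆∪p∣ {i = zero}  {inside  ∷ p} i∉p = contradiction here i∉p
∣⁅i⁆∪p∣ {i = suc i} {inside  ∷ p} i∉p = cong suc (∣⁅i⁆∪p∣ (i∉p ∘ there))
∣⁅i⁆∪p∣ {i = suc i} {outside ∷ p} i∉p = ∣⁅i⁆∪p∣ (i∉p ∘ there)

0<∣p∣⇒nonempty : ∀ {k} {p : Subset k} → 0 < ∣ p ∣ → Nonempty p
0<∣p∣⇒nonempty {k} {p} 0<∣p∣ with nonempty? p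
... | yes ne = ne
... | no ¬ne = contradiction (trans (cong ∣_∣ (Empty-unique ¬ne)) (∣⊥∣≡0 k)) (<⇒≢ 0<∣p∣ ∘ sym)

∈-tabulate⁺ : ∀ {k} {f : Fin k → Bool} {i} → f i ≡ true → i ∈ tabulate f
∈-tabulate⁺ {f = f} {i} fi = lookup⇒[]= i (tabulate f) (trans (lookup∘tabulate f i) fi)

∈-tabulate⁻ : ∀ {k} {f : Fin k → Bool} {i} → i ∈ tabulate f → f i ≡ true
∈-tabulate⁻ {f = f} {i} i∈ = trans (sym (lookup∘tabulate f i)) ([]=⇒lookup i∈)

∣tabulate∣-++ : ∀ m {k} (f : Fin (m + k) → Bool) →
                ∣ tabulate f ∣ ≡ ∣ tabulate (f ∘ (_↑ˡ k)) ∣ + ∣ tabulate (f ∘ (m ↑ʳ_)) ∣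
∣tabulate∣-++ zero    f = refl
∣tabulate∣-++ (suc m) f with f zero
... | true  = cong suc (∣tabulate∣-++ m (f ∘ suc))
... | false = ∣tabulate∣-++ m (f ∘ suc)

∣tabulate∣-combine : ∀ m {n} (f : Fin (m * n) → Bool) →
                     ∣ tabulate f ∣ ≡ ∑[ a < m ] ∣ tabulate (λ j → f (combine a j)) ∣
∣tabulate∣-combine zero        f = refl
∣tabulate∣-combine (suc m) {n} f = trans (∣tabulate∣-++ n f)
  (cong (∣ tabulate (λ j → f (combine {suc m} {n} zero j)) ∣ +_) (∣tabulate∣-combine m (f ∘ (n ↑ʳ_))))

independent∧dominating⇒maximal : ∀ {v} (G : Graph v) {S : Subset v} → Independent G S →
  (∀ a → a ∉ S → Σ[ b ∈ Fin v ] (b ∈ S × adj G a b ≡ true)) → MaximalIndependent G S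
independent∧dominating⇒maximal G {S} indS domS = indS , maximal
  where
  maximal : ∀ T → Independent G T → S ⊆ T → T ⊆ S
  maximal T indT S⊆T {a} a∈T with a ∈? S
  ... | yes a∈S = a∈S
  ... | no  a∉S with domS a a∉S
  ...   | b , b∈S , ab = contradiction (trans (sym ab) (indT a b a∈T (S⊆T b∈S))) λ ()

-- The subset {(a , j) ∣ j ∈ R a} of the product, under the identification of
-- Fin (m * n) with Fin m × Fin n used by _×ᴳ_.
rows : ∀ {m n} → (Fin m → Subset n) → Subset (m * n)
rows {m} {n} R = tabulate λ k → lookup (R (quotient n k)) (remainder {m} n k)

module _ {m n} (R : Fin m → Subset n) where

  ∈rows⁺ : ∀ {k} → remainder {m} n k ∈ R (quotient n k) → k ∈ rows R
  ∈rows⁺ = ∈-tabulate⁺ ∘ []=⇒lookup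

  ∈rows⁻ : ∀ {k} → k ∈ rows R → remainder {m} n k ∈ R (quotient n k)
  ∈rows⁻ = lookup⇒[]= _ _ ∘ ∈-tabulate⁻

  combine∈rows : ∀ {a j} → j ∈ R a → combine a j ∈ rows R
  combine∈rows {a} {j} j∈Ra = ∈rows⁺ (subst (λ (b , i) → i ∈ R b) (sym (remQuot-combine a j)) j∈Ra)

  ∣rows∣ : ∣ rows R ∣ ≡ ∑[ a < m ] ∣ R a ∣
  ∣rows∣ = trans (∣tabulate∣-combine m _) (sum-cong-≗ ∣row∣)
    where
    ∣row∣ : ∀ a → ∣ tabulate (λ j → lookup (R (quotient n (combine a j))) (remainder {m} n (combine a j))) ∣ ≡ ∣ R a ∣
    ∣row∣ a = cong ∣_∣ (trans (tabulate-cong (λ j → cong (λ (b , i) → lookup (R b) i) (remQuot-combine a j)))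
                              (tabulate∘lookup (R a)))

adj-×ᴳ-combine : ∀ {m n} (G : Graph m) (H : Graph n) k a j →
  adj (G ×ᴳ H) k (combine a j) ≡ adj G (quotient n k) a ∧ adj H (remainder {m} n k) j
adj-×ᴳ-combine {m} {n} G H k a j =
  cong (λ (b , i) → adj G (quotient n k) b ∧ adj H (remainder {m} n k) i) (remQuot-combine a j)

rows-maximalIndependent : ∀ {m n} (G : Graph m) (H : Graph n) (R : Fin m → Subset n) →
  (∀ {a b i j} → i ∈ R a → j ∈ R b → adj G a b ∧ adj H i j ≡ false) →
  (∀ {a i} → i ∉ R a → Σ[ b ∈ Fin m ] Σ[ j ∈ Fin n ] (j ∈ R b × adj G a b ∧ adj H i j ≡ true)) →
  MaximalIndependent (G ×ᴳ H) (rows R)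
rows-maximalIndependent {m} {n} G H R indR domR =
  independent∧dominating⇒maximal (G ×ᴳ H) (λ k l k∈ l∈ → indR (∈rows⁻ R k∈) (∈rows⁻ R l∈)) dominating
  where
  dominating : ∀ k → k ∉ rows R → Σ[ l ∈ Fin (m * n) ] (l ∈ rows R × adj (G ×ᴳ H) k l ≡ true)
  dominating k k∉ =
    let b , j , j∈Rb , adj≡true = domR (k∉ ∘ ∈rows⁺ R)
    in combine b j , combine∈rows R j∈Rb , trans (adj-×ᴳ-combine G H k b j) adj≡true

K-adj-≡ : ∀ {n} {i j : Fin n} → i ≡ j → adj (K n) i j ≡ false
K-adj-≡ {i = i} refl = adj-irrefl (K _) i

K-adj-≢ : ∀ {n} {i j : Fin n} → i ≢ j → adj (K n) i j ≡ true
K-adj-≢ {i = i} {j} i≢j with i ≟ j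
... | yes i≡j = contradiction i≡j i≢j
... | no  _   = refl

another : ∀ {n} → Fin (suc (suc n)) → Fin (suc (suc n))
another zero    = suc zero
another (suc _) = zero

another-≢ : ∀ {n} (i : Fin (suc (suc n))) → i ≢ another i
another-≢ zero    ()
another-≢ (suc _) ()

NoIsolatedVertexMinus : ∀ {v} → Graph v → Subset v → Set
NoIsolatedVertexMinus G W = ∀ a → a ∉ W → Σ[ b ∈ Fin _ ] (b ∉ W × adj G a b ≡ true)

hasNeighbourOutside? : ∀ {v} (G : Graph v) W a →
  Dec (a ∉ W → Σ[ b ∈ Fin v ] (b ∉ W × adj G a b ≡ true))
hasNeighbourOutside? G W a = ¬? (a ∈? W) →-dec any? λ b → ¬? (b ∈? W) ×-dec (adj G a b Bool.≟ true)

hasIsolatedVertexMinus⊎noIsolatedVertexMinus : ∀ {v} (G : Graph v) W →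
  HasIsolatedVertexMinus G W ⊎ NoIsolatedVertexMinus G W
hasIsolatedVertexMinus⊎noIsolatedVertexMinus {v} G W with all? (hasNeighbourOutside? G W)
... | yes noIsolated = inj₂ noIsolated
... | no ¬noIsolated =
  let a , ¬hasNeighbour = ¬∀⟶∃¬ v _ (hasNeighbourOutside? G W) ¬noIsolated
  in inj₁ (a , (λ a∈W → ¬hasNeighbour (λ a∉W → contradiction a∈W a∉W))
             , λ z z∉W → ¬-not λ az → ¬hasNeighbour λ _ → z , z∉W , az)

module _ {v} (G : Graph v) (x : Fin v) where

  x∈N[x] : x ∈ N[ G , x ]
  x∈N[x] = x∈p∪q⁺ (inj₁ (x∈⁅x⁆ x))

  adj⇒∈N[x] : ∀ {a} → adj G x a ≡ true → a ∈ N[ G , x ]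
  adj⇒∈N[x] xa = x∈p∪q⁺ (inj₂ (∈-tabulate⁺ xa))

  ∉N[x]⇒nonadjacent : ∀ {a} → a ∉ N[ G , x ] → adj G x a ≡ false
  ∉N[x]⇒nonadjacent a∉ = ¬-not (a∉ ∘ adj⇒∈N[x])

  ∈N[x]⇒adjacent : ∀ {a} → a ≢ x → a ∈ N[ G , x ] → adj G a x ≡ true
  ∈N[x]⇒adjacent {a} a≢x a∈ with x∈p∪q⁻ ⁅ x ⁆ (N G x) a∈
  ... | inj₁ a∈⁅x⁆ = contradiction (x∈⁅y⁆⇒x≡y x a∈⁅x⁆) a≢x
  ... | inj₂ a∈Nx  = trans (adj-sym G a x) (∈-tabulate⁻ a∈Nx)

  ∣N[x]∣≡1+deg : ∣ N[ G , x ] ∣ ≡ suc (deg G x)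
  ∣N[x]∣≡1+deg = ∣⁅i⁆∪p∣ {p = N G x} λ x∈Nx →
    contradiction (trans (sym (adj-irrefl G x)) (∈-tabulate⁻ x∈Nx)) λ ()

  0<deg⇒neighbour : 0 < deg G x → Σ[ b ∈ Fin v ] adj G x b ≡ true
  0<deg⇒neighbour 0<deg = let b , b∈Nx = 0<∣p∣⇒nonempty 0<deg in b , ∈-tabulate⁻ b∈Nx

  noIsolatedVertexMinus⇒neighbour : Σ[ b ∈ Fin v ] adj G x b ≡ true → NoIsolatedVertexMinus G N[ G , x ] →
                                    ∀ a → Σ[ b ∈ Fin v ] adj G a b ≡ true
  noIsolatedVertexMinus⇒neighbour x-nb noIsolated a with a ≟ x | a ∈? N[ G , x ]
  ... | yes refl | _     = x-nb
  ... | no  a≢x  | yes a∈ = x , ∈N[x]⇒adjacent a≢x a∈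
  ... | no  _    | no  a∉ = let b , _ , ab = noIsolated a a∉ in b , ab

layer : ∀ v n → Subset (v * suc n)
layer v n = rows {v} λ _ → ⁅ zero {n} ⁆

∣layer∣ : ∀ v n → ∣ layer v n ∣ ≡ v
∣layer∣ v n = begin
  ∣ layer v n ∣                 ≡⟨ ∣rows∣ {v} (λ _ → ⁅ zero ⁆) ⟩
  ∑[ a < v ] ∣ ⁅ zero {n} ⁆ ∣   ≡⟨ sum-cong-≗ {v} (λ _ → ∣⁅x⁆∣≡1 (zero {n})) ⟩
  ∑[ a < v ] 1                 ≡⟨ ∑-const v 1 ⟩
  v * 1                        ≡⟨ *-identityʳ v ⟩
  v                            ∎
  where open ≡-Reasoning

layer-maximalIndependent : ∀ {v} (G : Graph v) n → (∀ a → Σ[ b ∈ Fin v ] adj G a b ≡ true) →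
                           MaximalIndependent (G ×ᴳ K (suc n)) (layer v n)
layer-maximalIndependent G n neighbour = rows-maximalIndependent G (K (suc n)) _ independent dominating
  where
  independent : ∀ {a b i j} → i ∈ ⁅ zero ⁆ → j ∈ ⁅ zero ⁆ → adj G a b ∧ adj (K (suc n)) i j ≡ false
  independent {a} {b} i∈ j∈ =
    trans (cong (adj G a b ∧_) (K-adj-≡ (trans (x∈⁅y⁆⇒x≡y zero i∈) (sym (x∈⁅y⁆⇒x≡y zero j∈))))) (∧-zeroʳ _)
  dominating : ∀ {a i} → i ∉ ⁅ zero ⁆ →
               Σ[ b ∈ _ ] Σ[ j ∈ Fin (suc n) ] (j ∈ ⁅ zero ⁆ × adj G a b ∧ adj (K (suc n)) i j ≡ true)
  dominating {a} i∉ =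
    let b , ab = neighbour a in b , zero , x∈⁅x⁆ zero , cong₂ _∧_ ab (K-adj-≢ (x∉⁅y⁆⇒x≢y i∉))

module _ {v} (G : Graph v) (x : Fin v) where

  starRow : ∀ {n} → Fin v → Subset (suc n)
  starRow a with a ≟ x | a ∈? N[ G , x ]
  ... | yes _ | _     = ⊤
  ... | no  _ | yes _ = ⊥
  ... | no  _ | no  _ = ⁅ zero ⁆

  star : ∀ n → Subset (v * suc n)
  star n = rows (starRow {n})

  ∈starRow-centre : ∀ {n} {i : Fin (suc n)} → i ∈ starRow x
  ∈starRow-centre with x ≟ x
  ... | yes _   = ∈⊤
  ... | no  x≢x = contradiction refl x≢x

  zero∈starRow : ∀ {n a} → a ∉ N[ G , x ] → zero ∈ starRow {n} a
  zero∈starRow {a = a} a∉ with a ≟ x | a ∈? N[ G , x ]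
  ... | yes _ | _      = ∈⊤
  ... | no  _ | yes a∈ = contradiction a∈ a∉
  ... | no  _ | no  _  = x∈⁅x⁆ zero

  ∈starRow⁻ : ∀ {n a} {i : Fin (suc n)} → i ∈ starRow a → a ≡ x ⊎ (a ∉ N[ G , x ] × i ≡ zero)
  ∈starRow⁻ {a = a} i∈ with a ≟ x | a ∈? N[ G , x ]
  ... | yes a≡x | _     = inj₁ a≡x
  ... | no  _   | yes _ = contradiction i∈ ∉⊥
  ... | no  _   | no a∉ = inj₂ (a∉ , x∈⁅y⁆⇒x≡y zero i∈)

  ∉starRow⁻ : ∀ {n a} {i : Fin (suc n)} → i ∉ starRow a →
              (a ≢ x × a ∈ N[ G , x ]) ⊎ (a ∉ N[ G , x ] × i ≢ zero)
  ∉starRow⁻ {a = a} i∉ with a ≟ x | a ∈? N[ G , x ]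
  ... | yes _   | _      = contradiction ∈⊤ i∉
  ... | no  a≢x | yes a∈ = inj₁ (a≢x , a∈)
  ... | no  _   | no  a∉ = inj₂ (a∉ , x∉⁅y⁆⇒x≢y i∉)

  𝟙+∣starRow-centre∣ : ∀ {n} → 𝟙 (x ∈? N[ G , x ]) + ∣ starRow {n} x ∣ ≡ suc (suc n)
  𝟙+∣starRow-centre∣ {n} with x ≟ x | x ∈? N[ G , x ]
  ... | yes _   | yes _  = cong suc (∣⊤∣≡n (suc n))
  ... | yes _   | no x∉  = contradiction (x∈N[x] G x) x∉
  ... | no  x≢x | _      = contradiction refl x≢x

  𝟙+∣starRow∣ : ∀ {n a} → a ≢ x → 𝟙 (a ∈? N[ G , x ]) + ∣ starRow {n} a ∣ ≡ 1
  𝟙+∣starRow∣ {n} {a} a≢x with a ≟ x | a ∈? N[ G , x ]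
  ... | yes a≡x | _     = contradiction a≡x a≢x
  ... | no  _   | yes _ = cong suc (∣⊥∣≡0 (suc n))
  ... | no  _   | no  _ = ∣⁅x⁆∣≡1 (zero {n})

  ∣N[x]∣+∣star∣ : ∀ n → ∣ N[ G , x ] ∣ + ∣ star n ∣ ≡ suc n + v
  ∣N[x]∣+∣star∣ n = suc-injective (begin
    suc (∣ N[ G , x ] ∣ + ∣ star n ∣)
      ≡⟨ +-comm 1 _ ⟩
    ∣ N[ G , x ] ∣ + ∣ star n ∣ + 1
      ≡⟨ cong₂ (λ s t → s + t + 1) (∣p∣≡∑𝟙 N[ G , x ]) (∣rows∣ starRow) ⟩
    ∑[ a < v ] 𝟙 (a ∈? N[ G , x ]) + ∑[ a < v ] ∣ starRow {n} a ∣ + 1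
      ≡⟨ cong (_+ 1) (∑-distrib-+ (λ a → 𝟙 (a ∈? N[ G , x ])) (∣_∣ ∘ starRow {n})) ⟨
    ∑[ a < v ] (𝟙 (a ∈? N[ G , x ]) + ∣ starRow {n} a ∣) + 1
      ≡⟨ ∑-except {v} 1 _ x (λ _ → 𝟙+∣starRow∣ {n}) ⟩
    𝟙 (x ∈? N[ G , x ]) + ∣ starRow {n} x ∣ + v * 1
      ≡⟨ cong₂ _+_ 𝟙+∣starRow-centre∣ (*-identityʳ v) ⟩
    suc (suc n) + v
      ∎)
    where open ≡-Reasoning

  star-maximalIndependent : ∀ n → NoIsolatedVertexMinus G N[ G , x ] →
                            MaximalIndependent (G ×ᴳ K (suc (suc n))) (star (suc n))
  star-maximalIndependent n noIsolated =
    rows-maximalIndependent G (K (suc (suc n))) starRow independent dominating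
    where
    independent : ∀ {a b i j} → i ∈ starRow a → j ∈ starRow b → adj G a b ∧ adj (K (suc (suc n))) i j ≡ false
    independent {a} {b} i∈ j∈ with ∈starRow⁻ {a = a} i∈ | ∈starRow⁻ {a = b} j∈
    ... | inj₁ refl        | inj₁ refl        = cong (_∧ _) (adj-irrefl G x)
    ... | inj₁ refl        | inj₂ (b∉ , _)    = cong (_∧ _) (∉N[x]⇒nonadjacent G x b∉)
    ... | inj₂ (a∉ , _)    | inj₁ refl        = cong (_∧ _) (trans (adj-sym G a x) (∉N[x]⇒nonadjacent G x a∉))
    ... | inj₂ (_ , i≡0)   | inj₂ (_ , j≡0)   = trans (cong (adj G a b ∧_) (K-adj-≡ (trans i≡0 (sym j≡0)))) (∧-zeroʳ _)
    dominating : ∀ {a i} → i ∉ starRow a →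
                 Σ[ b ∈ Fin v ] Σ[ j ∈ _ ] (j ∈ starRow b × adj G a b ∧ adj (K (suc (suc n))) i j ≡ true)
    dominating {a} {i} i∉ with ∉starRow⁻ {a = a} i∉
    ... | inj₁ (a≢x , a∈) =
      x , another i , ∈starRow-centre , cong₂ _∧_ (∈N[x]⇒adjacent G x a≢x a∈) (K-adj-≢ (another-≢ i))
    ... | inj₂ (a∉ , i≢0) =
      let b , b∉ , ab = noIsolated a a∉ in b , zero , zero∈starRow b∉ , cong₂ _∧_ ab (K-adj-≢ i≢0)

lemma3p2 : (n : ℕ) → 2 ≤ n → ∀ {v} (G : Graph v) → WellCovered (G ×ᴳ K n) →
    ∀ (x : Fin v) → n ≤ deg G x → HasIsolatedVertexMinus G N[ G , x ]
lemma3p2 (suc (suc n)) (s≤s (s≤s z≤n)) {v} G wellCovered x n≤deg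
  with hasIsolatedVertexMinus⊎noIsolatedVertexMinus G N[ G , x ]
... | inj₁ isolated   = isolated
... | inj₂ noIsolated = contradiction (sym 1+deg≡n) (<⇒≢ (s≤s n≤deg))
  where
  neighbour : ∀ a → Σ[ b ∈ Fin v ] adj G a b ≡ true
  neighbour = noIsolatedVertexMinus⇒neighbour G x (0<deg⇒neighbour G x (≤-trans (s≤s z≤n) n≤deg)) noIsolated
  ∣star∣≡v : ∣ star G x (suc n) ∣ ≡ v
  ∣star∣≡v = trans (wellCovered _ _ (star-maximalIndependent G x n noIsolated)
                                    (layer-maximalIndependent G (suc n) neighbour))
                   (∣layer∣ v (suc n))
  1+deg≡n : suc (deg G x) ≡ suc (suc n)
  1+deg≡n = +-cancelʳ-≡ v _ _ (begin
    suc (deg G x) + v                     ≡⟨ cong₂ _+_ (∣N[x]∣≡1+deg G x) ∣star∣≡v ⟨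
    ∣ N[ G , x ] ∣ + ∣ star G x (suc n) ∣ ≡⟨ ∣N[x]∣+∣star∣ G x (suc n) ⟩
    suc (suc n) + v                       ∎)
    where open ≡-Reasoning
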